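{- Let $\epsilon>0$. Every graph $G=(V,E)$ on $n$ vertices has an edge partition $E=E_0\cup E_1\cup\cdots\cup E_k$ such that $|E_0|\le \epsilon n^2$, $k\le 50\epsilon^{ -2}$, and for $1\le i\le k$ the diameter of $E_i$ is at most $3$.
   Context: Graphs are finite and simple. The diameter of a connected graph is the maximum distance between two vertices ($\infty$ if disconnected). The diameter of an edge set $E'$ is the diameter of the graph with edge set $E'$ on the vertices covered by $E'$.
   Formalization: The parameter ε ranges over the positive rationals. -}

module Defs where

open import Data.Bool using (Bool; true; false; if_then_else_)
open import Data.Nat as ℕ using (ℕ; zero; suc)
open import Data.Fin using (Fin; toℕ)
open import Data.Fin.Properties using () renaming (_≟_ to _≟ᶠ_)
open import Data.List using (List; length; filter; allFin; concatMap; map)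
open import Data.Product using (_×_; _,_; ∃-syntax; Σ)
open import Data.Integer using (+_)
open import Data.Rational using (ℚ; 0ℚ; _<_; _/_; 1/_; positive)
open import Data.Rational.Properties using (pos⇒nonZero)
open import Relation.Binary.PropositionalEquality using (_≡_; _≢_)
open import Relation.Nullary using (Dec; yes; no; ¬_)
open import Relation.Nullary.Decidable using (_×-dec_)
open import Data.Bool.Properties using () renaming (_≟_ to _≟ᵇ_)

record Graph (n : ℕ) : Set where
  field
    adj    : Fin n → Fin n → Bool
    sym    : ∀ u v → adj u v ≡ adj v u
    irrefl : ∀ v → adj v v ≡ false
open Graph public

Edge : ∀ {n} → Graph n → Fin n → Fin n → Set
Edge G u v = adj G u v ≡ true

-- An edge partition E = E₀ ∪ E₁ ∪ … ∪ E_k is given by a colouring of the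
-- edges with colours in Fin (suc k): colour zero is E₀, colour (suc j) is
-- E_{j+1}.
record EdgePartition {n : ℕ} (G : Graph n) (k : ℕ) : Set where
  field
    col     : Fin n → Fin n → Fin (suc k)
    col-sym : ∀ u v → Edge G u v → col u v ≡ col v u
open EdgePartition public

InClass : ∀ {n k} {G : Graph n} → EdgePartition G k → Fin (suc k) → Fin n → Fin n → Set
InClass {G = G} P i u v = Edge G u v × col P u v ≡ i

data Walk {n k} {G : Graph n} (P : EdgePartition G k) (i : Fin (suc k))
          : ℕ → Fin n → Fin n → Set where
  here : ∀ {v} → Walk P i zero v v
  step : ∀ {ℓ u w v} → InClass P i u w → Walk P i ℓ w v → Walk P i (suc ℓ) u v

DistLe : ∀ {n k} {G : Graph n} → EdgePartition G k → Fin (suc k) → Fin n → Fin n → ℕ → Set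
DistLe P i u v d = ∃[ ℓ ] (ℓ ℕ.≤ d × Walk P i ℓ u v)

Covered : ∀ {n k} {G : Graph n} → EdgePartition G k → Fin (suc k) → Fin n → Set
Covered P i v = ∃[ w ] InClass P i v w

-- The diameter of edge class i (the graph with those edges on the vertices
-- they cover) is at most d: any two covered vertices are at distance ≤ d
-- (disconnected means diameter ∞, which is then excluded).
DiamLe : ∀ {n k} {G : Graph n} → EdgePartition G k → Fin (suc k) → ℕ → Set
DiamLe P i d = ∀ u v → Covered P i u → Covered P i v → DistLe P i u v d

classSize : ∀ {n k} {G : Graph n} → EdgePartition G k → Fin (suc k) → ℕ
classSize {n} {G = G} P i =
  length (filter (λ uv → (toℕ (Data.Product.proj₁ uv) ℕ.<? toℕ (Data.Product.proj₂ uv))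
                           ×-dec (adj G (Data.Product.proj₁ uv) (Data.Product.proj₂ uv) ≟ᵇ true)
                           ×-dec (col P (Data.Product.proj₁ uv) (Data.Product.proj₂ uv) ≟ᶠ i))
                 (concatMap (λ u → map (λ v → (u , v)) (allFin n)) (allFin n)))

ℕ→ℚ : ℕ → ℚ
ℕ→ℚ m = + m / 1

inv : (ε : ℚ) → 0ℚ < ε → ℚ
inv ε ε>0 = (1/ ε) {{pos⇒nonZero ε {{positive ε>0}}}}

-- Count the edges of a graph on n vertices as arcs (ordered pairs), D of them.  Applying
-- Cauchy–Schwarz twice, there are at least D⁴/n⁴ closed walks of length four, and grouping
-- them by their middle arc uw shows that they number the sum over arcs uw of the arcs xy
-- with x ∈ N(u), y ∈ N(w).  For an arc uw maximising this count, the arcs between N(u) and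
-- N(w) form a "star" with at least D³/n⁴ arcs and diameter at most 3: every vertex it covers
-- is joined within it to u or to w.  Removing such stars one after another, 1/D² grows by at
-- least 2/n⁴ per round, so after K = ⌊ε⁻²⌋ rounds at most n²/√(2K) ≤ εn² arcs are left
-- over; they form E₀.

module Submission where

open import Defs hiding (sym)
open import Data.Nat using (ℕ; zero; suc; z≤n)
open import Data.Fin using (Fin; zero; suc)
open import Data.Product using (_×_; ∃-syntax; Σ)

import Data.Nat as ℕ
import Data.Nat.Properties as ℕ
open import Data.Product using (_,_)
open import Relation.Binary.PropositionalEquality using (_≡_; refl; sym; trans; cong; subst; subst₂)

-- A separate module keeps its natural-number operators apart from the rational ones below.
module Peeling where

  open import Algebra.Properties.Semiring.Sum ℕ.+-*-semiring
    using (sum; sum-syntax; ∑-distrib-+; ∑-comm; *-distribˡ-sum; *-distribʳ-sum)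
  open import Data.Bool using (Bool; true; false; _∧_; _∨_; not; if_then_else_)
  open import Data.Bool.Properties using (∧-comm; ∨-comm; ∨-zeroʳ) renaming (_≟_ to _≟ᵇ_)
  open import Data.Fin using (toℕ; punchIn)
  open import Data.Fin.Properties using (punchIn-injective; punchInᵢ≢i) renaming (_≟_ to _≟ᶠ_)
  open import Data.List using (List; []; _∷_; _++_; length; filter; map; concatMap; allFin; tabulate)
  open import Data.List.Extrema.Nat using (argmax; f[xs]≤f[argmax])
  open import Data.List.Membership.Propositional.Properties using (∈-allFin)
  open import Data.List.Properties using (map-++; map-∘)
  import Data.List.Relation.Unary.All as All
  open import Data.Nat using (zero; suc; _+_; _*_; _≤_; _≤?_; _/_; _%_; z≤n; s≤s)
  open import Data.Nat.DivMod using (m≡m%n+[m/n]*n; m%n<n; m/n*n≤m; m≥n⇒m/n>0)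
  open import Data.Nat.ListAction using () renaming (sum to sumˡ)
  open import Data.Nat.ListAction.Properties using (sum-++)
  open import Data.Nat.Properties
  open import Data.Nat.Solver using (module +-*-Solver)
  open +-*-Solver using (solve; _:+_; _:*_; _:=_; con)
  open import Data.Product using (proj₁; proj₂)
  open import Data.Sum as Sum using (_⊎_; inj₁; inj₂)
  open import Function using (_∘_; case_of_)
  open import Relation.Binary.PropositionalEquality using (cong₂; module ≡-Reasoning)
  open import Relation.Nullary using (yes; no; contradiction)
  open import Relation.Nullary.Decidable using (_×-dec_)
  open import Relation.Unary using (Decidable)

  infix 8 _²

  _² : ℕ → ℕ
  m ² = m * m

  ∑-cong : ∀ {n} {f g : Fin n → ℕ} → (∀ i → f i ≡ g i) → ∑[ i < n ] f i ≡ ∑[ i < n ] g i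
  ∑-cong {zero} _ = refl
  ∑-cong {suc n} f≡g = cong₂ _+_ (f≡g zero) (∑-cong (f≡g ∘ suc))

  ∑-mono-≤ : ∀ {n} {f g : Fin n → ℕ} → (∀ i → f i ≤ g i) → ∑[ i < n ] f i ≤ ∑[ i < n ] g i
  ∑-mono-≤ {zero} _ = z≤n
  ∑-mono-≤ {suc n} f≤g = +-mono-≤ (f≤g zero) (∑-mono-≤ (f≤g ∘ suc))

  ∑-const : ∀ n c → ∑[ i < n ] c ≡ n * c
  ∑-const zero c = refl
  ∑-const (suc n) c = cong (c +_) (∑-const n c)

  2mn≤m²+n² : ∀ m n → 2 * (m * n) ≤ m ² + n ²
  2mn≤m²+n² m n with ≤-total m n
  ... | inj₁ m≤n with m≤n⇒∃[o]m+o≡n m≤n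
  ...   | d , refl = subst (2 * (m * (m + d)) ≤_)
            (solve 2 (λ m d → con 2 :* (m :* (m :+ d)) :+ d :* d := m :* m :+ (m :+ d) :* (m :+ d)) refl m d)
            (m≤m+n _ (d ²))
  2mn≤m²+n² m n | inj₂ n≤m with m≤n⇒∃[o]m+o≡n n≤m
  ...   | d , refl = subst (2 * ((n + d) * n) ≤_)
            (solve 2 (λ n d → con 2 :* ((n :+ d) :* n) :+ d :* d := (n :+ d) :* (n :+ d) :+ n :* n) refl n d)
            (m≤m+n _ (d ²))

  ∑-square : ∀ {n} (f : Fin n → ℕ) → (∑[ i < n ] f i) ² ≡ ∑[ i < n ] ∑[ j < n ] (f i * f j)
  ∑-square {n} f = begin
    (∑[ i < n ] f i) ²                 ≡⟨ *-distribʳ-sum (∑[ j < n ] f j) f ⟩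
    ∑[ i < n ] (f i * ∑[ j < n ] f j)  ≡⟨ ∑-cong (λ i → *-distribˡ-sum (f i) f) ⟩
    ∑[ i < n ] ∑[ j < n ] (f i * f j)  ∎
    where open ≡-Reasoning

  -- Summing 2 f i f j ≤ f i ² + f j ² over all pairs (i, j).
  cauchy-schwarz : ∀ {n} (f : Fin n → ℕ) → (∑[ i < n ] f i) ² ≤ n * ∑[ i < n ] (f i ²)
  cauchy-schwarz {n} f = *-cancelˡ-≤ 2 (begin
    2 * (∑[ i < n ] f i) ²
      ≡⟨ cong (2 *_) (∑-square f) ⟩
    2 * ∑[ i < n ] ∑[ j < n ] (f i * f j)
      ≡⟨ *-distribˡ-sum 2 (λ i → ∑[ j < n ] (f i * f j)) ⟩
    ∑[ i < n ] (2 * ∑[ j < n ] (f i * f j))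
      ≡⟨ ∑-cong (λ i → *-distribˡ-sum 2 (λ j → f i * f j)) ⟩
    ∑[ i < n ] ∑[ j < n ] (2 * (f i * f j))
      ≤⟨ ∑-mono-≤ (λ i → ∑-mono-≤ (λ j → 2mn≤m²+n² (f i) (f j))) ⟩
    ∑[ i < n ] ∑[ j < n ] (f i ² + f j ²)
      ≡⟨ ∑-cong (λ i → ∑-distrib-+ (λ _ → f i ²) (λ j → f j ²)) ⟩
    ∑[ i < n ] (∑[ j < n ] (f i ²) + ∑[ j < n ] (f j ²))
      ≡⟨ ∑-distrib-+ (λ i → ∑[ j < n ] (f i ²)) (λ _ → ∑[ j < n ] (f j ²)) ⟩
    ∑[ i < n ] ∑[ j < n ] (f i ²) + ∑[ i < n ] ∑[ j < n ] (f j ²)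
      ≡⟨ cong₂ _+_ (∑-cong (λ i → ∑-const n (f i ²))) (∑-const n (∑[ j < n ] (f j ²))) ⟩
    ∑[ i < n ] (n * f i ²) + n * ∑[ j < n ] (f j ²)
      ≡⟨ cong (_+ n * ∑[ j < n ] (f j ²)) (sym (*-distribˡ-sum n (λ i → f i ²))) ⟩
    n * ∑[ i < n ] (f i ²) + n * ∑[ j < n ] (f j ²)
      ≡⟨ solve 1 (λ x → x :+ x := con 2 :* x) refl (n * ∑[ i < n ] (f i ²)) ⟩
    2 * (n * ∑[ i < n ] (f i ²)) ∎)
    where open ≤-Reasoning

  *-distribˡ-∑∑ : ∀ {m n} c (f : Fin m → Fin n → ℕ) →
                  c * ∑[ i < m ] ∑[ j < n ] f i j ≡ ∑[ i < m ] ∑[ j < n ] (c * f i j)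
  *-distribˡ-∑∑ {n = n} c f =
    trans (*-distribˡ-sum c (λ i → ∑[ j < n ] f i j)) (∑-cong (λ i → *-distribˡ-sum c (f i)))

  length-filter≤sum : ∀ {A : Set} {P : A → Set} (P? : Decidable P) (f : A → ℕ) → (∀ a → P a → 1 ≤ f a) →
                      ∀ xs → length (filter P? xs) ≤ sumˡ (map f xs)
  length-filter≤sum P? f P⇒1≤f [] = z≤n
  length-filter≤sum P? f P⇒1≤f (x ∷ xs) with P? x
  ... | yes px = +-mono-≤ (P⇒1≤f x px) (length-filter≤sum P? f P⇒1≤f xs)
  ... | no  _  = ≤-trans (length-filter≤sum P? f P⇒1≤f xs) (m≤n+m _ (f x))

  sum-map-tabulate : ∀ {A : Set} {n} (g : A → ℕ) (h : Fin n → A) → sumˡ (map g (tabulate h)) ≡ ∑[ i < n ] g (h i)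
  sum-map-tabulate {n = zero}  g h = refl
  sum-map-tabulate {n = suc n} g h = cong (g (h zero) +_) (sum-map-tabulate g (λ i → h (suc i)))

  sum-map-concatMap : ∀ {A B : Set} (g : B → ℕ) (F : A → List B) xs →
                      sumˡ (map g (concatMap F xs)) ≡ sumˡ (map (λ a → sumˡ (map g (F a))) xs)
  sum-map-concatMap g F [] = refl
  sum-map-concatMap g F (x ∷ xs) = begin
    sumˡ (map g (F x ++ concatMap F xs))
      ≡⟨ cong sumˡ (map-++ g (F x) (concatMap F xs)) ⟩
    sumˡ (map g (F x) ++ map g (concatMap F xs))
      ≡⟨ sum-++ (map g (F x)) _ ⟩
    sumˡ (map g (F x)) + sumˡ (map g (concatMap F xs))
      ≡⟨ cong (sumˡ (map g (F x)) +_) (sum-map-concatMap g F xs) ⟩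
    sumˡ (map g (F x)) + sumˡ (map (λ a → sumˡ (map g (F a))) xs) ∎
    where open ≡-Reasoning

  sum-map-allPairs : ∀ {n} (g : Fin n × Fin n → ℕ) →
    sumˡ (map g (concatMap (λ u → map (λ v → (u , v)) (allFin n)) (allFin n))) ≡ ∑[ u < n ] ∑[ v < n ] g (u , v)
  sum-map-allPairs {n} g = begin
    sumˡ (map g (concatMap pairsWith (allFin n)))
      ≡⟨ sum-map-concatMap g pairsWith (allFin n) ⟩
    sumˡ (map (λ u → sumˡ (map g (pairsWith u))) (allFin n))
      ≡⟨ sum-map-tabulate (λ u → sumˡ (map g (pairsWith u))) (λ u → u) ⟩
    ∑[ u < n ] sumˡ (map g (pairsWith u))
      ≡⟨ ∑-cong (λ u → cong sumˡ (sym (map-∘ {g = g} {f = λ v → (u , v)} (allFin n)))) ⟩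
    ∑[ u < n ] sumˡ (map (λ v → g (u , v)) (allFin n))
      ≡⟨ ∑-cong (λ u → sum-map-tabulate (λ v → g (u , v)) (λ v → v)) ⟩
    ∑[ u < n ] ∑[ v < n ] g (u , v) ∎
    where
    open ≡-Reasoning
    pairsWith : Fin n → List (Fin n × Fin n)
    pairsWith u = map (λ v → (u , v)) (allFin n)

  -- Closed walks of length four

  BoolRel : ℕ → Set
  BoolRel n = Fin n → Fin n → Bool

  IsSymmetric : ∀ {n} → BoolRel n → Set
  IsSymmetric S = ∀ x y → S x y ≡ S y x

  ⟦_⟧ : Bool → ℕ
  ⟦ true ⟧ = 1
  ⟦ false ⟧ = 0

  module _ {n : ℕ} where

    -- Every edge is counted twice, once in each direction.
    arcs : BoolRel n → ℕ
    arcs S = ∑[ x < n ] ∑[ y < n ] ⟦ S x y ⟧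

    degree : BoolRel n → Fin n → ℕ
    degree S u = ∑[ x < n ] ⟦ S x u ⟧

    paths₂ : BoolRel n → Fin n → Fin n → ℕ
    paths₂ S x w = ∑[ u < n ] (⟦ S x u ⟧ * ⟦ S u w ⟧)

    closedWalks₄ : BoolRel n → ℕ
    closedWalks₄ S = ∑[ x < n ] ∑[ w < n ] (paths₂ S x w ²)

    links : BoolRel n → Fin n → Fin n → ℕ
    links S u w = ∑[ x < n ] ∑[ y < n ] (⟦ S x u ⟧ * ⟦ S y w ⟧ * ⟦ S x y ⟧)

    weight : BoolRel n → Fin n → Fin n → ℕ
    weight S u w = ⟦ S u w ⟧ * links S u w

    ∑-degree : ∀ S → ∑[ u < n ] degree S u ≡ arcs S
    ∑-degree S = ∑-comm (λ u x → ⟦ S x u ⟧)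

    ∑-degree² : ∀ {S} → IsSymmetric S → ∑[ u < n ] (degree S u ²) ≡ ∑[ x < n ] ∑[ w < n ] paths₂ S x w
    ∑-degree² {S} sym-S = begin
      ∑[ u < n ] (degree S u * degree S u)
        ≡⟨ ∑-cong (λ u → cong (degree S u *_) (∑-cong (λ w → cong ⟦_⟧ (sym-S w u)))) ⟩
      ∑[ u < n ] (degree S u * ∑[ w < n ] ⟦ S u w ⟧)
        ≡⟨ ∑-cong (λ u → *-distribʳ-sum _ (λ x → ⟦ S x u ⟧)) ⟩
      ∑[ u < n ] ∑[ x < n ] (⟦ S x u ⟧ * ∑[ w < n ] ⟦ S u w ⟧)
        ≡⟨ ∑-cong (λ u → ∑-cong (λ x → *-distribˡ-sum ⟦ S x u ⟧ (λ w → ⟦ S u w ⟧))) ⟩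
      ∑[ u < n ] ∑[ x < n ] ∑[ w < n ] (⟦ S x u ⟧ * ⟦ S u w ⟧)
        ≡⟨ ∑-comm (λ u x → ∑[ w < n ] (⟦ S x u ⟧ * ⟦ S u w ⟧)) ⟩
      ∑[ x < n ] ∑[ u < n ] ∑[ w < n ] (⟦ S x u ⟧ * ⟦ S u w ⟧)
        ≡⟨ ∑-cong (λ x → ∑-comm (λ u w → ⟦ S x u ⟧ * ⟦ S u w ⟧)) ⟩
      ∑[ x < n ] ∑[ w < n ] paths₂ S x w ∎
      where open ≡-Reasoning

    -- Cauchy–Schwarz twice: once over degrees, once over paths of length two.
    arcs⁴≤n⁴*closedWalks₄ : ∀ {S} → IsSymmetric S → (arcs S ²) ² ≤ (n ²) ² * closedWalks₄ S
    arcs⁴≤n⁴*closedWalks₄ {S} sym-S = begin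
      (arcs S ²) ²         ≤⟨ *-mono-≤ degrees degrees ⟩
      (n * D) * (n * D)    ≡⟨ solve 2 (λ n d → (n :* d) :* (n :* d) := (n :* n) :* (d :* d)) refl n D ⟩
      n ² * D ²            ≤⟨ *-monoʳ-≤ (n ²) paths ⟩
      n ² * (n * (n * W))  ≡⟨ solve 2 (λ n w → (n :* n) :* (n :* (n :* w)) := ((n :* n) :* (n :* n)) :* w) refl n W ⟩
      (n ²) ² * W          ∎
      where
      open ≤-Reasoning
      D = ∑[ u < n ] (degree S u ²)
      W = closedWalks₄ S
      P : Fin n → ℕ
      P x = ∑[ w < n ] paths₂ S x w
      degrees : arcs S ² ≤ n * D
      degrees = subst (λ a → a ² ≤ n * D) (∑-degree S) (cauchy-schwarz (degree S))
      paths : D ² ≤ n * (n * W)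
      paths = begin
        D ²
          ≡⟨ cong _² (∑-degree² sym-S) ⟩
        (∑[ x < n ] P x) ²
          ≤⟨ cauchy-schwarz P ⟩
        n * ∑[ x < n ] (P x ²)
          ≤⟨ *-monoʳ-≤ n (∑-mono-≤ (λ x → cauchy-schwarz (paths₂ S x))) ⟩
        n * ∑[ x < n ] (n * ∑[ w < n ] (paths₂ S x w ²))
          ≡⟨ cong (n *_) (sym (*-distribˡ-sum n (λ x → ∑[ w < n ] (paths₂ S x w ²)))) ⟩
        n * (n * W) ∎

    closedWalks₄≡∑weight : ∀ S → closedWalks₄ S ≡ ∑[ u < n ] ∑[ w < n ] weight S u w
    closedWalks₄≡∑weight S = begin
      ∑[ x < n ] ∑[ w < n ] (paths₂ S x w ²)
        ≡⟨ ∑-cong (λ x → ∑-cong (λ w → ∑-square (λ u → ⟦ S x u ⟧ * ⟦ S u w ⟧))) ⟩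
      ∑[ x < n ] ∑[ w < n ] ∑[ u < n ] ∑[ y < n ] g x w u y
        ≡⟨ ∑-cong (λ x → ∑-comm (λ w u → ∑[ y < n ] g x w u y)) ⟩
      ∑[ x < n ] ∑[ u < n ] ∑[ w < n ] ∑[ y < n ] g x w u y
        ≡⟨ ∑-comm (λ x u → ∑[ w < n ] ∑[ y < n ] g x w u y) ⟩
      ∑[ u < n ] ∑[ x < n ] ∑[ w < n ] ∑[ y < n ] g x w u y
        ≡⟨ ∑-cong (λ u → ∑-comm (λ x w → ∑[ y < n ] g x w u y)) ⟩
      ∑[ u < n ] ∑[ w < n ] ∑[ x < n ] ∑[ y < n ] g x w u y
        ≡⟨ ∑-cong (λ u → ∑-cong (λ w → ∑-cong (λ x → ∑-cong (λ y → regroup x w u y)))) ⟩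
      ∑[ u < n ] ∑[ w < n ] ∑[ x < n ] ∑[ y < n ] (⟦ S u w ⟧ * l u w x y)
        ≡⟨ ∑-cong (λ u → ∑-cong (λ w → sym (*-distribˡ-∑∑ ⟦ S u w ⟧ (l u w)))) ⟩
      ∑[ u < n ] ∑[ w < n ] weight S u w ∎
      where
      open ≡-Reasoning
      g : Fin n → Fin n → Fin n → Fin n → ℕ
      g x w u y = (⟦ S x u ⟧ * ⟦ S u w ⟧) * (⟦ S x y ⟧ * ⟦ S y w ⟧)
      l : Fin n → Fin n → Fin n → Fin n → ℕ
      l u w x y = ⟦ S x u ⟧ * ⟦ S y w ⟧ * ⟦ S x y ⟧
      regroup : ∀ x w u y → g x w u y ≡ ⟦ S u w ⟧ * l u w x y
      regroup x w u y = solve 4 (λ a b c d → (a :* b) :* (c :* d) := b :* (a :* d :* c)) refl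
        ⟦ S x u ⟧ ⟦ S u w ⟧ ⟦ S x y ⟧ ⟦ S y w ⟧

    closedWalks₄≤arcs* : ∀ S M → (∀ u w → S u w ≡ true → links S u w ≤ M) → closedWalks₄ S ≤ arcs S * M
    closedWalks₄≤arcs* S M links≤M = begin
      closedWalks₄ S                         ≡⟨ closedWalks₄≡∑weight S ⟩
      ∑[ u < n ] ∑[ w < n ] weight S u w     ≤⟨ ∑-mono-≤ (λ u → ∑-mono-≤ (λ w → bound u w)) ⟩
      ∑[ u < n ] ∑[ w < n ] (⟦ S u w ⟧ * M)  ≡⟨ ∑-cong (λ u → sym (*-distribʳ-sum M (λ w → ⟦ S u w ⟧))) ⟩
      ∑[ u < n ] (∑[ w < n ] ⟦ S u w ⟧ * M)  ≡⟨ sym (*-distribʳ-sum M (λ u → ∑[ w < n ] ⟦ S u w ⟧)) ⟩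
      arcs S * M                             ∎
      where
      open ≤-Reasoning
      bound : ∀ u w → weight S u w ≤ ⟦ S u w ⟧ * M
      bound u w with S u w in uw
      ... | true  = *-monoʳ-≤ 1 (links≤M u w uw)
      ... | false = z≤n

    arcs≤n² : ∀ S → arcs S ≤ n ²
    arcs≤n² S = begin
      arcs S                   ≤⟨ ∑-mono-≤ (λ x → ∑-mono-≤ (λ y → ⟦⟧≤1 (S x y))) ⟩
      ∑[ x < n ] ∑[ y < n ] 1  ≡⟨ ∑-cong {n = n} {g = λ _ → n} (λ _ → trans (∑-const n 1) (*-identityʳ n)) ⟩
      ∑[ x < n ] n             ≡⟨ ∑-const n n ⟩
      n ²                      ∎
      where
      open ≤-Reasoning
      ⟦⟧≤1 : ∀ b → ⟦ b ⟧ ≤ 1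
      ⟦⟧≤1 true  = s≤s z≤n
      ⟦⟧≤1 false = z≤n

  -- Stars

  _⊆_ : ∀ {n} → BoolRel n → BoolRel n → Set
  T ⊆ S = ∀ x y → T x y ≡ true → S x y ≡ true

  _∖_ : ∀ {n} → BoolRel n → BoolRel n → BoolRel n
  (S ∖ T) x y = S x y ∧ not (T x y)

  ⟦⟧-split : ∀ s t → (t ≡ true → s ≡ true) → ⟦ s ⟧ ≡ ⟦ s ∧ not t ⟧ + ⟦ t ⟧
  ⟦⟧-split true  true  _ = refl
  ⟦⟧-split true  false _ = refl
  ⟦⟧-split false false _ = refl
  ⟦⟧-split false true  t⇒s with () ← t⇒s refl

  arcs-∖ : ∀ {n} {S T : BoolRel n} → T ⊆ S → arcs S ≡ arcs (S ∖ T) + arcs T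
  arcs-∖ {n} {S} {T} T⊆S = trans
    (∑-cong (λ x → trans (∑-cong (λ y → ⟦⟧-split (S x y) (T x y) (T⊆S x y)))
                         (∑-distrib-+ (λ y → ⟦ (S ∖ T) x y ⟧) (λ y → ⟦ T x y ⟧))))
    (∑-distrib-+ (λ x → ∑[ y < n ] ⟦ (S ∖ T) x y ⟧) (λ x → ∑[ y < n ] ⟦ T x y ⟧))

  ∖-sym : ∀ {n} {S T : BoolRel n} → IsSymmetric S → IsSymmetric T → IsSymmetric (S ∖ T)
  ∖-sym sym-S sym-T x y = cong₂ (λ s t → s ∧ not t) (sym-S x y) (sym-T x y)

  ∖⊆ : ∀ {n} {S T : BoolRel n} → (S ∖ T) ⊆ S
  ∖⊆ {S = S} x y xy with S x y
  ... | true = refl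
  ... | false = xy

  ∖⇒∉ : ∀ {n} {S T : BoolRel n} {x y} → (S ∖ T) x y ≡ true → T x y ≡ false
  ∖⇒∉ {S = S} {T} {x} {y} xy with S x y | T x y
  ... | _     | false = refl
  ... | true  | true  = sym xy
  ... | false | true  = case xy of λ ()

  star : ∀ {n} → BoolRel n → Fin n → Fin n → BoolRel n
  star S u w x y = S u w ∧ (S x y ∧ ((S x u ∧ S y w) ∨ (S x w ∧ S y u)))

  module _ {n : ℕ} {S : BoolRel n} {u w : Fin n} where

    star⊆ : star S u w ⊆ S
    star⊆ x y xy with S u w | S x y
    ... | true  | true = refl
    ... | true  | false = xy
    ... | false | _ = case xy of λ ()

    star⇒hub : ∀ {x y} → star S u w x y ≡ true → S u w ≡ true
    star⇒hub xy with S u w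
    ... | true = refl
    ... | false = xy

    star⇒near-hub : ∀ {x y} → star S u w x y ≡ true → S x u ≡ true ⊎ S x w ≡ true
    star⇒near-hub {x} {y} xy with S u w | S x y | S x u | S x w
    ... | _     | _     | true  | _     = inj₁ refl
    ... | _     | _     | false | true  = inj₂ refl
    ... | true  | true  | false | false = case xy of λ ()
    ... | true  | false | false | false = case xy of λ ()
    ... | false | _     | false | false = case xy of λ ()

    star-spokeᵘ : ∀ {x} → S u w ≡ true → S x u ≡ true → star S u w x u ≡ true
    star-spokeᵘ uw xu rewrite uw | xu = refl

    star-spokeʷ : ∀ {x} → IsSymmetric S → S u w ≡ true → S x w ≡ true → star S u w x w ≡ true
    star-spokeʷ {x} sym-S uw xw rewrite uw | xw | trans (sym-S w u) uw =
      ∨-zeroʳ (S x u ∧ S w w)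

    star-sym : IsSymmetric S → IsSymmetric (star S u w)
    star-sym sym-S x y rewrite sym-S x y
      | ∨-comm (S x u ∧ S y w) (S x w ∧ S y u) | ∧-comm (S x w) (S y u) | ∧-comm (S x u) (S y w) = refl

    weight≤arcs-star : weight S u w ≤ arcs (star S u w)
    weight≤arcs-star = ≤-trans (≤-reflexive (*-distribˡ-∑∑ ⟦ S u w ⟧ (λ x y → ⟦ S x u ⟧ * ⟦ S y w ⟧ * ⟦ S x y ⟧)))
        (∑-mono-≤ (λ x → ∑-mono-≤ (λ y → pointwise (S u w) (S x u) (S y w) (S x y) (S x w ∧ S y u))))
      where
      pointwise : ∀ a b c d e → ⟦ a ⟧ * (⟦ b ⟧ * ⟦ c ⟧ * ⟦ d ⟧) ≤ ⟦ a ∧ (d ∧ ((b ∧ c) ∨ e)) ⟧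
      pointwise true true true true _ = s≤s z≤n
      pointwise false _ _ _ _ = z≤n
      pointwise true false _ _ _ = z≤n
      pointwise true true false _ _ = z≤n
      pointwise true true true false _ = z≤n

  -- Peeling off best stars

  -- Opaque: letting the type checker unfold the maximisation makes checking intractable.
  opaque
    argmaxᶠ : ∀ {m} → (Fin (suc m) → ℕ) → Fin (suc m)
    argmaxᶠ {m} f = argmax f zero (allFin (suc m))

    ≤-argmaxᶠ : ∀ {m} (f : Fin (suc m) → ℕ) i → f i ≤ f (argmaxᶠ f)
    ≤-argmaxᶠ {m} f i = All.lookup (f[xs]≤f[argmax] {f = f} zero (allFin (suc m))) (∈-allFin i)

  -- If D³ ≤ N δ then removing δ from D raises 1/D² by at least 2/N.
  potential-step : ∀ N s D' δ → (D' + δ) * (D' + δ) ² ≤ N * δ → 2 * s * (D' + δ) ² ≤ N →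
                   2 * suc s * D' ² ≤ N
  potential-step N s zero δ _ _ rewrite *-zeroʳ (2 * suc s) = z≤n
  potential-step N s D'@(suc _) δ D³≤Nδ 2sD²≤N = *-cancelʳ-≤ (2 * suc s * D' ²) N (D ²) (begin
      2 * suc s * D' ² * D ²
        ≡⟨ solve 3 (λ s a b → con 2 :* (con 1 :+ s) :* a :* b := con 2 :* s :* b :* a :+ con 2 :* b :* a) refl s (D' ²) (D ²) ⟩
      2 * s * D ² * D' ² + 2 * D ² * D' ²
        ≤⟨ +-mono-≤ (*-monoˡ-≤ (D' ²) 2sD²≤N) gain ⟩
      N * D' ² + N * (δ * (D + D'))
        ≡⟨ solve 3 (λ N a d → N :* (a :* a) :+ N :* (d :* ((a :+ d) :+ a)) := N :* ((a :+ d) :* (a :+ d))) refl N D' δ ⟩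
      N * D ² ∎)
    where
    open ≤-Reasoning
    D = D' + δ
    2D'²≤D[D+D'] : 2 * D' ² ≤ D * (D + D')
    2D'²≤D[D+D'] = subst (2 * D' ² ≤_)
      (solve 2 (λ a d → con 2 :* (a :* a) :+ (con 3 :* a :* d :+ d :* d) := (a :+ d) :* ((a :+ d) :+ a)) refl D' δ)
      (m≤m+n (2 * D' ²) _)
    gain : 2 * D ² * D' ² ≤ N * (δ * (D + D'))
    gain = begin
      2 * D ² * D' ²        ≡⟨ solve 2 (λ a b → con 2 :* a :* b := a :* (con 2 :* b)) refl (D ²) (D' ²) ⟩
      D ² * (2 * D' ²)      ≤⟨ *-monoʳ-≤ (D ²) 2D'²≤D[D+D'] ⟩
      D ² * (D * (D + D'))  ≡⟨ solve 2 (λ a b → (a :* a) :* (a :* b) := a :* (a :* a) :* b) refl D (D + D') ⟩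
      D * D ² * (D + D')    ≤⟨ *-monoˡ-≤ (D + D') D³≤Nδ ⟩
      N * δ * (D + D')      ≡⟨ *-assoc N δ (D + D') ⟩
      N * (δ * (D + D'))    ∎

  module _ {m : ℕ} where

    private
      n : ℕ
      n = suc m

    opaque
      partner : BoolRel n → Fin n → Fin n
      partner S u = argmaxᶠ (weight S u)

      hubᵘ : BoolRel n → Fin n
      hubᵘ S = argmaxᶠ (λ u → weight S u (partner S u))

      hubʷ : BoolRel n → Fin n
      hubʷ S = partner S (hubᵘ S)

      weight≤weight-hub : ∀ S u w → weight S u w ≤ weight S (hubᵘ S) (hubʷ S)
      weight≤weight-hub S u w =
        ≤-trans (≤-argmaxᶠ (weight S u) w) (≤-argmaxᶠ (λ u → weight S u (partner S u)) u)

    bestStar : BoolRel n → BoolRel n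
    bestStar S = star S (hubᵘ S) (hubʷ S)

    bestStar⊆ : ∀ {S} → bestStar S ⊆ S
    bestStar⊆ {S} = star⊆ {S = S} {hubᵘ S} {hubʷ S}

    bestStar-sym : ∀ {S} → IsSymmetric S → IsSymmetric (bestStar S)
    bestStar-sym {S} = star-sym {S = S} {hubᵘ S} {hubʷ S}

    peel : BoolRel n → BoolRel n
    peel S = S ∖ bestStar S

    peel^ : ℕ → BoolRel n → BoolRel n
    peel^ zero    S = S
    peel^ (suc k) S = peel^ k (peel S)

    links≤arcs-bestStar : ∀ S u w → S u w ≡ true → links S u w ≤ arcs (bestStar S)
    links≤arcs-bestStar S u w uw = begin
      links S u w                 ≡⟨ sym (+-identityʳ _) ⟩
      ⟦ true ⟧ * links S u w      ≡⟨ cong (λ b → ⟦ b ⟧ * links S u w) (sym uw) ⟩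
      weight S u w                ≤⟨ weight≤weight-hub S u w ⟩
      weight S (hubᵘ S) (hubʷ S)  ≤⟨ weight≤arcs-star {S = S} ⟩
      arcs (bestStar S)           ∎
      where open ≤-Reasoning

    arcs³≤n⁴*arcs-bestStar : ∀ {S} → IsSymmetric S → arcs S * arcs S ² ≤ (n ²) ² * arcs (bestStar S)
    arcs³≤n⁴*arcs-bestStar {S} sym-S = cancel (arcs S) (≤-trans (arcs⁴≤n⁴*closedWalks₄ sym-S)
      (*-monoʳ-≤ ((n ²) ²) (closedWalks₄≤arcs* S (arcs (bestStar S)) (links≤arcs-bestStar S))))
      where
      N = (n ²) ²
      B = arcs (bestStar S)
      cancel : ∀ a → (a ²) ² ≤ N * (a * B) → a * a ² ≤ N * B
      cancel zero    _ = z≤n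
      cancel a@(suc _) a⁴≤Nab = *-cancelˡ-≤ a (subst₂ _≤_
        (solve 1 (λ a → (a :* a) :* (a :* a) := a :* (a :* (a :* a))) refl a)
        (solve 3 (λ N a b → N :* (a :* b) := a :* (N :* b)) refl N a B) a⁴≤Nab)

    peel-sym : ∀ {S} → IsSymmetric S → IsSymmetric (peel S)
    peel-sym sym-S = ∖-sym sym-S (bestStar-sym sym-S)

    peel^-sym : ∀ k {S} → IsSymmetric S → IsSymmetric (peel^ k S)
    peel^-sym zero    sym-S = sym-S
    peel^-sym (suc k) sym-S = peel^-sym k (peel-sym sym-S)

    potential-peel^ : ∀ k s {S} → IsSymmetric S → 2 * s * arcs S ² ≤ (n ²) ² →
                      2 * (s + k) * arcs (peel^ k S) ² ≤ (n ²) ²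
    potential-peel^ zero s {S} _ bound =
      subst (λ t → 2 * t * arcs S ² ≤ (n ²) ²) (sym (+-identityʳ s)) bound
    potential-peel^ (suc k) s {S} sym-S bound =
      subst (λ t → 2 * t * arcs (peel^ k (peel S)) ² ≤ (n ²) ²) (sym (+-suc s k))
        (potential-peel^ k (suc s) (peel-sym sym-S)
          (potential-step ((n ²) ²) s (arcs (peel S)) (arcs (bestStar S))
            (subst (λ D → D * D ² ≤ (n ²) ² * arcs (bestStar S)) split (arcs³≤n⁴*arcs-bestStar sym-S))
            (subst (λ D → 2 * s * D ² ≤ (n ²) ²) split bound)))
      where
      split : arcs S ≡ arcs (peel S) + arcs (bestStar S)
      split = arcs-∖ (bestStar⊆ {S = S})

    peel^⊆ : ∀ k {S : BoolRel n} → peel^ k S ⊆ S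
    peel^⊆ zero    x y xy = xy
    peel^⊆ (suc k) {S} x y xy = ∖⊆ {S = S} {bestStar S} x y (peel^⊆ k x y xy)

    later-star-disjoint : ∀ k S {x y} → bestStar (peel^ k (peel S)) x y ≡ true → bestStar S x y ≡ false
    later-star-disjoint k S {x} {y} xy =
      ∖⇒∉ {S = S} {bestStar S} (peel^⊆ k x y (bestStar⊆ {S = peel^ k (peel S)} x y xy))

    -- Colour suc j marks the best star removed in round j; colour zero marks what is left after K rounds.
    colour : ∀ K → BoolRel n → Fin n → Fin n → Fin (suc K)
    colour zero    S x y = zero
    colour (suc K) S x y = if bestStar S x y then suc zero else punchIn (suc zero) (colour K (peel S) x y)

    colour-sym : ∀ K {S} → IsSymmetric S → ∀ x y → colour K S x y ≡ colour K S y x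
    colour-sym zero    sym-S x y = refl
    colour-sym (suc K) {S} sym-S x y
      rewrite bestStar-sym sym-S x y | colour-sym K (peel-sym sym-S) x y = refl

    colour≡suc⇒bestStar : ∀ K S x y (j : Fin K) → colour K S x y ≡ suc j → bestStar (peel^ (toℕ j) S) x y ≡ true
    colour≡suc⇒bestStar (suc K) S x y j c≡j with bestStar S x y in xy
    colour≡suc⇒bestStar (suc K) S x y zero    _   | true = xy
    colour≡suc⇒bestStar (suc K) S x y (suc j) c≡j | true = case c≡j of λ ()
    colour≡suc⇒bestStar (suc K) S x y zero    c≡j | false = case punchInᵢ≢i (suc zero) _ c≡j of λ ()
    colour≡suc⇒bestStar (suc K) S x y (suc j) c≡j | false =
      colour≡suc⇒bestStar K (peel S) x y j (punchIn-injective (suc zero) _ (suc j) c≡j)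

    bestStar⇒colour≡suc : ∀ K S x y (j : Fin K) → bestStar (peel^ (toℕ j) S) x y ≡ true → colour K S x y ≡ suc j
    bestStar⇒colour≡suc (suc K) S x y zero xy rewrite xy = refl
    bestStar⇒colour≡suc (suc K) S x y (suc j) xy with bestStar S x y in xy∈B
    ... | true  = case trans (sym xy∈B) (later-star-disjoint (toℕ j) S xy) of λ ()
    ... | false = cong (punchIn (suc zero)) (bestStar⇒colour≡suc K (peel S) x y j xy)

    colour≡zero⇒peel^ : ∀ K S x y → colour K S x y ≡ zero → S x y ≡ true → peel^ K S x y ≡ true
    colour≡zero⇒peel^ zero    S x y _ xy = xy
    colour≡zero⇒peel^ (suc K) S x y c≡0 xy with bestStar S x y in xy∈B
    ... | true = case c≡0 of λ ()
    ... | false = colour≡zero⇒peel^ K (peel S) x y (punchIn-injective (suc zero) _ zero c≡0) peel-xy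
      where
      peel-xy : peel S x y ≡ true
      peel-xy rewrite xy | xy∈B = refl

  module _ {n k} {G : Graph n} (P : EdgePartition G k) {i : Fin (suc k)} where

    InClass-sym : ∀ {x y} → InClass P i x y → InClass P i y x
    InClass-sym {x} {y} (xy , colxy) =
      trans (Graph.sym G y x) xy , trans (sym (EdgePartition.col-sym P x y xy)) colxy

    diam≤3-of-hub : ∀ u w → (∀ x → Covered P i x → InClass P i u w × (InClass P i x u ⊎ InClass P i x w)) →
                    DiamLe P i 3
    diam≤3-of-hub u w near x x' cov-x cov-x' with near x cov-x | near x' cov-x'
    ... | uw , inj₁ xu | _ , inj₁ x'u = 2 , s≤s (s≤s z≤n) , step xu (step (InClass-sym x'u) here)
    ... | uw , inj₂ xw | _ , inj₂ x'w = 2 , s≤s (s≤s z≤n) , step xw (step (InClass-sym x'w) here)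
    ... | uw , inj₁ xu | _ , inj₂ x'w = 3 , ≤-refl , step xu (step uw (step (InClass-sym x'w) here))
    ... | uw , inj₂ xw | _ , inj₁ x'u = 3 , ≤-refl , step xw (step (InClass-sym uw) (step (InClass-sym x'u) here))

  module _ {m : ℕ} (G : Graph (suc m)) (K : ℕ) where

    peelingPartition : EdgePartition G K
    peelingPartition = record
      { col     = colour K (adj G)
      ; col-sym = λ x y _ → colour-sym K (Graph.sym G) x y
      }

    classSize-leftover : classSize peelingPartition zero ≤ arcs (peel^ K (adj G))
    classSize-leftover = subst (classSize peelingPartition zero ≤_) (sum-map-allPairs leftover)
      (length-filter≤sum (λ xy → (toℕ (proj₁ xy) ℕ.<? toℕ (proj₂ xy))
                                 ×-dec (adj G (proj₁ xy) (proj₂ xy) ≟ᵇ true)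
                                 ×-dec (colour K (adj G) (proj₁ xy) (proj₂ xy) ≟ᶠ zero))
        leftover counted (concatMap (λ x → map (λ y → (x , y)) (allFin (suc m))) (allFin (suc m))))
      where
      leftover : Fin (suc m) × Fin (suc m) → ℕ
      leftover (x , y) = ⟦ peel^ K (adj G) x y ⟧
      counted : ∀ xy → (toℕ (proj₁ xy) ℕ.< toℕ (proj₂ xy)) × (adj G (proj₁ xy) (proj₂ xy) ≡ true)
                       × (colour K (adj G) (proj₁ xy) (proj₂ xy) ≡ zero) → 1 ≤ leftover xy
      counted (x , y) (_ , xy , c≡0) rewrite colour≡zero⇒peel^ K (adj G) x y c≡0 xy = s≤s z≤n

    diam-peelingPartition : ∀ j → DiamLe peelingPartition (suc j) 3
    diam-peelingPartition j = diam≤3-of-hub peelingPartition u w near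
      where
      T = peel^ (toℕ j) (adj G)
      u = hubᵘ T
      w = hubʷ T
      sym-T : IsSymmetric T
      sym-T = peel^-sym (toℕ j) (Graph.sym G)
      inClass : ∀ {x y} → bestStar T x y ≡ true → InClass peelingPartition (suc j) x y
      inClass {x} {y} xy = peel^⊆ (toℕ j) x y (bestStar⊆ {S = T} x y xy) , bestStar⇒colour≡suc K (adj G) x y j xy
      spokeᵘ : ∀ {x} → T u w ≡ true → T x u ≡ true → InClass peelingPartition (suc j) x u
      spokeᵘ uw xu = inClass (star-spokeᵘ {S = T} {u} {w} uw xu)
      spokeʷ : ∀ {x} → T u w ≡ true → T x w ≡ true → InClass peelingPartition (suc j) x w
      spokeʷ uw xw = inClass (star-spokeʷ {S = T} {u} {w} sym-T uw xw)
      near : ∀ x → Covered peelingPartition (suc j) x →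
             InClass peelingPartition (suc j) u w
             × (InClass peelingPartition (suc j) x u ⊎ InClass peelingPartition (suc j) x w)
      near x (y , _ , c≡j) = spokeʷ uw uw , Sum.map (spokeᵘ uw) (spokeʷ uw) (star⇒near-hub {S = T} xy)
        where
        xy = colour≡suc⇒bestStar K (adj G) x y j c≡j
        uw = star⇒hub {S = T} xy

  ²-cancel-≤ : ∀ {m n} → m ² ≤ n ² → m ≤ n
  ²-cancel-≤ {m} {n} m²≤n² with m ≤? n
  ... | yes m≤n = m≤n
  ... | no  m≰n = contradiction m²≤n² (<⇒≱ (*-mono-< (≰⇒> m≰n) (≰⇒> m≰n)))

  -- For ε = (p + 1) / (q + 1) this is ⌊ε⁻²⌋.
  rounds : ℕ → ℕ → ℕ
  rounds p q = suc q ² / suc p ²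

  rounds*[p+1]²≤50*[q+1]² : ∀ p q → rounds p q * suc p ² ≤ 50 * suc q ²
  rounds*[p+1]²≤50*[q+1]² p q = ≤-trans (m/n*n≤m (suc q ²) (suc p ²)) (m≤n*m (suc q ²) 50)

  [q+1]²≤2*rounds*[p+1]² : ∀ {p q} → p ≤ q → suc q ² ≤ 2 * rounds p q * suc p ²
  [q+1]²≤2*rounds*[p+1]² {p} {q} p≤q = begin
    Q              ≡⟨ m≡m%n+[m/n]*n Q P ⟩
    Q % P + K * P  ≤⟨ +-monoˡ-≤ (K * P) (<⇒≤ (m%n<n Q P)) ⟩
    P + K * P      ≤⟨ +-monoˡ-≤ (K * P) (subst (_≤ K * P) (*-identityˡ P) (*-monoˡ-≤ P K≥1)) ⟩
    K * P + K * P  ≡⟨ solve 2 (λ k p → k :* p :+ k :* p := con 2 :* k :* p) refl K P ⟩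
    2 * K * P      ∎
    where
    open ≤-Reasoning
    P = suc p ²
    Q = suc q ²
    K = rounds p q
    K≥1 : 1 ≤ K
    K≥1 = m≥n⇒m/n>0 {Q} {P} (*-mono-≤ (s≤s p≤q) (s≤s p≤q))

  leftover-bound : ∀ p q E N → 2 * rounds p q * E ² ≤ N ² → E ≤ N → E * suc q ≤ suc p * N
  leftover-bound p q E N bound E≤N with suc p ≤? suc q
  ... | no  p≰q = ≤-trans (*-mono-≤ E≤N (<⇒≤ (≰⇒> p≰q))) (≤-reflexive (*-comm N (suc p)))
  ... | yes (s≤s p≤q) = ²-cancel-≤ (begin
    (E * suc q) ²
      ≡⟨ solve 2 (λ e q → (e :* q) :* (e :* q) := (e :* e) :* (q :* q)) refl E (suc q) ⟩
    E ² * suc q ²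
      ≤⟨ *-monoʳ-≤ (E ²) ([q+1]²≤2*rounds*[p+1]² p≤q) ⟩
    E ² * (2 * K * suc p ²)
      ≡⟨ solve 3 (λ e k p → (e :* e) :* (con 2 :* k :* p) := (con 2 :* k :* (e :* e)) :* p) refl E K (suc p ²) ⟩
    2 * K * E ² * suc p ²
      ≤⟨ *-monoˡ-≤ (suc p ²) bound ⟩
    N ² * suc p ²
      ≡⟨ solve 2 (λ n p → (n :* n) :* (p :* p) := (p :* n) :* (p :* n)) refl N (suc p) ⟩
    (suc p * N) ² ∎)
    where
    open ≤-Reasoning
    K = rounds p q

open Peeling

open import Data.Rational using (ℚ; 0ℚ; _<_; _≤_; _*_; mkℚ; toℚᵘ; *<*)
open import Data.Integer as ℤ using (+_; +[1+_]; -[1+_])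
open import Data.Integer.Properties using (pos-*)
open import Data.Nat.Coprimality using (Coprime)
open import Data.Rational.Properties using (toℚᵘ-cancel-≤; toℚᵘ-fromℚᵘ; toℚᵘ-homo-*)
open import Data.Rational.Unnormalised as ℚᵘ using (mkℚᵘ; *≤*; _≃_)
import Data.Rational.Unnormalised.Properties as ℚᵘ

-- mkℚᵘ a b denotes a / (b + 1).
mkℚᵘ-* : ∀ a b c d → mkℚᵘ (+ a) b ℚᵘ.* mkℚᵘ (+ c) d ≡ mkℚᵘ (+ (a ℕ.* c)) (d ℕ.+ b ℕ.* suc d)
mkℚᵘ-* a b c d = cong (λ z → mkℚᵘ z (d ℕ.+ b ℕ.* suc d)) (sym (pos-* a c))

toℚᵘ-ℕ→ℚ : ∀ m → toℚᵘ (ℕ→ℚ m) ≃ mkℚᵘ (+ m) 0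
toℚᵘ-ℕ→ℚ m = toℚᵘ-fromℚᵘ (mkℚᵘ (+ m) 0)

ℕ→ℚ-≤ : ∀ {y} E c d → toℚᵘ y ≃ mkℚᵘ (+ c) d → E ℕ.* suc d ℕ.≤ c → ℕ→ℚ E ≤ y
ℕ→ℚ-≤ E c d y≃c/d E[d+1]≤c = toℚᵘ-cancel-≤
  (ℚᵘ.≤-respˡ-≃ (ℚᵘ.≃-sym (toℚᵘ-ℕ→ℚ E)) (ℚᵘ.≤-respʳ-≃ (ℚᵘ.≃-sym y≃c/d)
    (*≤* (subst₂ ℤ._≤_ (pos-* E (suc d)) (pos-* c 1)
      (ℤ.+≤+ (subst (E ℕ.* suc d ℕ.≤_) (sym (ℕ.*-identityʳ c)) E[d+1]≤c))))))

module _ (p q : ℕ) .(c : Coprime (suc p) (suc q)) where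

  private
    ε : ℚ
    ε = mkℚ +[1+ p ] q c

  ℕ→ℚ-≤-ε*n² : ∀ E n → E ℕ.* suc q ℕ.≤ suc p ℕ.* (n ℕ.* n) → ℕ→ℚ E ≤ ε * (ℕ→ℚ n * ℕ→ℚ n)
  ℕ→ℚ-≤-ε*n² E n bound = ℕ→ℚ-≤ E _ _ ε*n²≃
    (subst (λ d → E ℕ.* suc d ℕ.≤ _) (sym (ℕ.*-identityʳ q)) bound)
    where
    ε*n²≃ : toℚᵘ (ε * (ℕ→ℚ n * ℕ→ℚ n)) ≃ mkℚᵘ (+ (suc p ℕ.* (n ℕ.* n))) (0 ℕ.+ q ℕ.* 1)
    ε*n²≃ = ℚᵘ.≃-trans (toℚᵘ-homo-* ε (ℕ→ℚ n * ℕ→ℚ n))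
      (ℚᵘ.≃-trans (ℚᵘ.*-congˡ {toℚᵘ ε} (ℚᵘ.≃-trans (toℚᵘ-homo-* (ℕ→ℚ n) (ℕ→ℚ n)) (ℚᵘ.*-cong (toℚᵘ-ℕ→ℚ n) (toℚᵘ-ℕ→ℚ n))))
      (ℚᵘ.≃-reflexive (trans (cong (mkℚᵘ +[1+ p ] q ℚᵘ.*_) (mkℚᵘ-* n 0 n 0)) (mkℚᵘ-* (suc p) q (n ℕ.* n) 0))))

  ℕ→ℚ-≤-50/ε² : ∀ (ε>0 : 0ℚ < ε) K → K ℕ.* (suc p ℕ.* suc p) ℕ.≤ 50 ℕ.* (suc q ℕ.* suc q) →
                ℕ→ℚ K ≤ ℕ→ℚ 50 * (inv ε ε>0 * inv ε ε>0)
  ℕ→ℚ-≤-50/ε² ε>0 K bound = ℕ→ℚ-≤ K _ _ 50/ε²≃ (subst (λ e → K ℕ.* e ℕ.≤ 50 ℕ.* (suc q ℕ.* suc q)) p+1²≡ bound)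
    where
    ε⁻¹ = inv ε ε>0
    d : ℕ
    d = p ℕ.+ p ℕ.* suc p
    50/ε²≃ : toℚᵘ (ℕ→ℚ 50 * (ε⁻¹ * ε⁻¹)) ≃ mkℚᵘ (+ (50 ℕ.* (suc q ℕ.* suc q))) (d ℕ.+ 0 ℕ.* suc d)
    50/ε²≃ = ℚᵘ.≃-trans (toℚᵘ-homo-* (ℕ→ℚ 50) (ε⁻¹ * ε⁻¹))
      (ℚᵘ.≃-trans (ℚᵘ.*-cong (toℚᵘ-ℕ→ℚ 50) (toℚᵘ-homo-* ε⁻¹ ε⁻¹))
      (ℚᵘ.≃-reflexive (trans (cong (mkℚᵘ (+ 50) 0 ℚᵘ.*_) (mkℚᵘ-* (suc q) p (suc q) p)) (mkℚᵘ-* 50 0 (suc q ℕ.* suc q) d))))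
    p+1²≡ : suc p ℕ.* suc p ≡ suc (d ℕ.+ 0 ℕ.* suc d)
    p+1²≡ = cong suc (sym (ℕ.+-identityʳ d))

emptyPartition : (G : Graph 0) → EdgePartition G 0
emptyPartition G = record { col = λ () ; col-sym = λ () }

theorem2p6 : (ε : ℚ) (ε>0 : 0ℚ < ε) (n : ℕ) (G : Graph n) →
    ∃[ k ] Σ (EdgePartition G k) λ P →
    (ℕ→ℚ (classSize P zero) ≤ ε * (ℕ→ℚ n * ℕ→ℚ n)
    × ℕ→ℚ k ≤ ℕ→ℚ 50 * (inv ε ε>0 * inv ε ε>0)
    × (∀ (j : Fin k) → DiamLe P (suc j) 3))
theorem2p6 (mkℚ (+ zero) _ _) (*<* (ℤ.+<+ ()))
theorem2p6 (mkℚ -[1+ _ ]   _ _) (*<* ())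
theorem2p6 (mkℚ +[1+ p ] q c) ε>0 zero G =
  0 , emptyPartition G , ℕ→ℚ-≤-ε*n² p q c 0 0 z≤n , ℕ→ℚ-≤-50/ε² p q c ε>0 0 z≤n , λ ()
theorem2p6 (mkℚ +[1+ p ] q c) ε>0 n@(suc _) G =
  K , P ,
  ℕ→ℚ-≤-ε*n² p q c (classSize P zero) n leftover-small ,
  ℕ→ℚ-≤-50/ε² p q c ε>0 K (rounds*[p+1]²≤50*[q+1]² p q) ,
  diam-peelingPartition G K
  where
  K = rounds p q
  P = peelingPartition G K
  E = arcs (peel^ K (adj G))
  leftover-small : classSize P zero ℕ.* suc q ℕ.≤ suc p ℕ.* (n ℕ.* n)
  leftover-small = ℕ.≤-trans (ℕ.*-monoˡ-≤ (suc q) (classSize-leftover G K))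
    (leftover-bound p q E (n ²) (potential-peel^ K 0 (Graph.sym G) z≤n) (arcs≤n² (peel^ K (adj G))))
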